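{- For instances of fixed order scheduling with deadlines in which the slacks are non-decreasing along the fixed order ($d_1-p_1\le d_2-p_2\le\cdots\le d_n-p_n$), the first-fit algorithm is a $2$-approximation, i.e. $FF(I)\le 2\,OPT(I)$ for every such instance $I$; moreover this bound is tight: for every $\varepsilon>0$ there is such an instance with $FF(I)/OPT(I)>2-\varepsilon$.
   Context: Fixed order scheduling with deadlines: there are $n$ jobs $1,\dots,n$, job $j$ having processing time $p_j\in\mathbb{N}$, $p_j>0$, and deadline $d_j\in\mathbb{N}$ with $d_j\ge p_j$; the slack of job $j$ is $d_j-p_j$. All jobs are released at time $0$, and there are sufficiently many identical machines. Each machine processes its assigned jobs non-preemptively, without idle time, in increasing order of job index. A schedule is feasible if, for every job $j$, the total processing time of jobs $k\le j$ on the machine of $j$ is at most $d_j$. $OPT(I)$ is the minimum number of machines used (receiving at least one job) by a feasible schedule. The first-fit algorithm considers jobs in order $1,\dots,n$ and appends each job to the lowest-indexed open machine on which it would meet its deadline, opening a new machine if there is none; $FF(I)$ is the number of machines it opens. -}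

module Defs where

open import Data.Nat using (ℕ; zero; suc; _+_; _*_; _∸_; _≤_; _<_; _≤?_; _≤ᵇ_)
open import Data.Bool using (Bool; true; false; if_then_else_; _∧_)
open import Data.Fin using (Fin; toℕ; _≟_)
open import Data.Fin.Properties using (any?)
open import Data.List using (List; []; _∷_; length; map; filter; allFin; lookup)
open import Data.Nat.ListAction using (sum)
open import Data.Product using (Σ; _×_; _,_; ∃)
open import Relation.Nullary using (yes; no)
open import Relation.Nullary.Decidable using (⌊_⌋)
open import Relation.Binary.PropositionalEquality using (_≡_)

record Job : Set where
  constructor job
  field
    p   : ℕ
    d   : ℕ
    p>0 : 0 < p
    p≤d : p ≤ d
open Job public

-- An instance: the jobs in the fixed order 1,…,n (list position = index).
Instance : Set
Instance = List Job

slack : Job → ℕ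
slack J = d J ∸ p J

SlackMonotone : Instance → Set
SlackMonotone I = (i j : Fin (length I)) → toℕ i ≤ toℕ j →
  slack (lookup I i) ≤ slack (lookup I j)

Schedule : Instance → ℕ → Set
Schedule I m = Fin (length I) → Fin m

completion : (I : Instance) {m : ℕ} → Schedule I m → Fin (length I) → ℕ
completion I σ j = sum (map (λ k → if (toℕ k ≤ᵇ toℕ j) ∧ ⌊ σ k ≟ σ j ⌋
                                   then p (lookup I k) else 0)
                            (allFin (length I)))

Feasible : (I : Instance) {m : ℕ} → Schedule I m → Set
Feasible I σ = (j : Fin (length I)) → completion I σ j ≤ d (lookup I j)

machinesUsed : (I : Instance) {m : ℕ} → Schedule I m → ℕ
machinesUsed I {m} σ = length (filter (λ i → any? (λ j → σ j ≟ i)) (allFin m))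

IsOPT : Instance → ℕ → Set
IsOPT I k =
  (Σ ℕ λ m → Σ (Schedule I m) λ σ → Feasible I σ × machinesUsed I σ ≡ k)
  × ((m : ℕ) (σ : Schedule I m) → Feasible I σ → k ≤ machinesUsed I σ)

-- First fit. State: list of loads of open machines, in order of opening.
-- Put job J on the first machine whose load + p J ≤ d J, else open a new one.
place : Job → List ℕ → List ℕ
place J []       = p J ∷ []
place J (ℓ ∷ ls) with ℓ + p J ≤? d J
... | yes _ = (ℓ + p J) ∷ ls
... | no  _ = ℓ ∷ place J ls

ffLoads : List ℕ → Instance → List ℕ
ffLoads ls []      = ls
ffLoads ls (J ∷ I) = ffLoads (place J ls) I

FF : Instance → ℕ
FF I = length (ffLoads [] I)

{-# OPTIONS --safe #-}
module Submission where

-- Fix a job T with slack s and a cap c, and cap every processing time at c.  In a feasible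
-- schedule the jobs before T on any one machine have capped total at most s + c: the last of
-- them, j, starts by time s_j ≤ s and adds at most c; on the machine of T they even total at
-- most s.  Summing over the machines gives  Σ_{i<T} min(p_i, c) + c ≤ OPT · (s + c).
-- If first fit opens a new machine for T, each of its ℓ open machines has load > s, so for
-- c = s + 1 they contribute ℓ · c to Σ min(load, c), which (capping being subadditive) never
-- exceeds Σ_{i<T} min(p_i, c); hence (ℓ + 1) · c ≤ OPT · 2c.
-- Tightness: b(b+1) unit jobs with deadline b+1 followed by b+1 jobs of length b+1 and
-- deadline 2b+1, all of slack b.  First fit uses b + (b+1) machines; round robin on b+1
-- machines is feasible, and the bound above for the last job rules out b machines.

open import Defs
open import Data.Bool using (true; false; if_then_else_; _∧_)
open import Data.Fin using (Fin; toℕ; fromℕ<) renaming (zero to fzero; suc to fsuc)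
import Data.Fin.Properties as Fin
open import Data.List using (List; []; _∷_; _++_; length; map; filter; lookup; tabulate; drop; replicate)
import Data.List.Properties as List
open import Data.List.Relation.Unary.All using (All; []; _∷_)
open import Data.List.Relation.Unary.All.Properties using (tabulate⁺)
open import Data.Nat using (ℕ; zero; suc; _+_; _*_; _≤_; _<_; _⊓_; _%_; _≤ᵇ_; z≤n; s≤s)
open import Data.Nat.DivMod using (m%n<n; m<n⇒m%n≡m; [m+n]%n≡m%n; [m+kn]%n≡m%n)
import Data.Nat.ListAction as List
open import Data.Nat.Properties
open import Algebra.Properties.CommutativeMonoid.Sum +-0-commutativeMonoid
  using (sum; sum-replicate-zero; ∑-distrib-+)
open import Data.Nat.Tactic.RingSolver using (solve-∀)
open import Data.Product using (Σ; _,_; _×_; ∃; proj₂)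
open import Data.Sum using (_⊎_; inj₁; inj₂)
open import Function using (id; _∘_)
open import Relation.Nullary using (Dec; does; yes; no; ¬_; contradiction)
open import Relation.Nullary.Decidable using (⌊_⌋; dec-true; dec-false)
open import Relation.Binary.PropositionalEquality
  using (_≡_; _≢_; refl; sym; trans; cong; cong₂; subst; subst₂; module ≡-Reasoning)

sumBelow : ℕ → (ℕ → ℕ) → ℕ
sumBelow zero    f = 0
sumBelow (suc t) f = sumBelow t f + f t

sumBelow-cong : ∀ t {f g} → (∀ i → i < t → f i ≡ g i) → sumBelow t f ≡ sumBelow t g
sumBelow-cong zero    f≡g = refl
sumBelow-cong (suc t) f≡g =
  cong₂ _+_ (sumBelow-cong t (λ i i<t → f≡g i (m<n⇒m<1+n i<t))) (f≡g t ≤-refl)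

sumBelow-mono-≤ : ∀ t {f g} → (∀ i → i < t → f i ≤ g i) → sumBelow t f ≤ sumBelow t g
sumBelow-mono-≤ zero    f≤g = z≤n
sumBelow-mono-≤ (suc t) f≤g =
  +-mono-≤ (sumBelow-mono-≤ t (λ i i<t → f≤g i (m<n⇒m<1+n i<t))) (f≤g t ≤-refl)

sumBelow-zero : ∀ t {f} → (∀ i → i < t → f i ≡ 0) → sumBelow t f ≡ 0
sumBelow-zero zero    f≡0 = refl
sumBelow-zero (suc t) f≡0 =
  cong₂ _+_ (sumBelow-zero t (λ i i<t → f≡0 i (m<n⇒m<1+n i<t))) (f≡0 t ≤-refl)

sumBelow-+ : ∀ a e f → sumBelow (a + e) f ≡ sumBelow a f + sumBelow e (λ i → f (a + i))
sumBelow-+ a zero    f = trans (cong (λ t → sumBelow t f) (+-identityʳ a)) (sym (+-identityʳ _))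
sumBelow-+ a (suc e) f = begin
  sumBelow (a + suc e) f                                  ≡⟨ cong (λ t → sumBelow t f) (+-suc a e) ⟩
  sumBelow (a + e) f + f (a + e)                          ≡⟨ cong (_+ f (a + e)) (sumBelow-+ a e f) ⟩
  sumBelow a f + sumBelow e (λ i → f (a + i)) + f (a + e) ≡⟨ +-assoc (sumBelow a f) _ _ ⟩
  sumBelow a f + sumBelow (suc e) (λ i → f (a + i))       ∎
  where open ≡-Reasoning

sumBelow-const : ∀ t x → sumBelow t (λ _ → x) ≡ t * x
sumBelow-const zero    x = refl
sumBelow-const (suc t) x = trans (cong (_+ x) (sumBelow-const t x)) (+-comm (t * x) x)

sumBelow-prefix-≤ : ∀ {t u} f → t ≤ u → sumBelow t f ≤ sumBelow u f
sumBelow-prefix-≤ {t} f t≤u with m≤n⇒∃[o]m+o≡n t≤u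
... | e , refl = subst (sumBelow t f ≤_) (sym (sumBelow-+ t e f)) (m≤m+n _ _)

sumBelow-indicator : ∀ {u t} y → u < t → sumBelow t (λ i → if does (i ≟ u) then y else 0) ≡ y
sumBelow-indicator {u} {suc t} y u<1+t with m<1+n⇒m<n∨m≡n u<1+t
... | inj₁ u<t  rewrite dec-false (t ≟ u) (>⇒≢ u<t) = trans (+-identityʳ _) (sumBelow-indicator y u<t)
... | inj₂ refl rewrite dec-true (u ≟ u) refl =
  cong (_+ y) (sumBelow-zero u (λ i i<u → cong (if_then y else 0) (dec-false (i ≟ u) (<⇒≢ i<u))))

sumBelow-tabulate : ∀ n (g : Fin n → ℕ) f → (∀ a → g a ≡ f (toℕ a)) →
                    List.sum (tabulate g) ≡ sumBelow n f
sumBelow-tabulate zero    g f g≡f = refl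
sumBelow-tabulate (suc n) g f g≡f = trans
  (cong₂ _+_ (g≡f fzero) (sumBelow-tabulate n (g ∘ fsuc) (f ∘ suc) (g≡f ∘ fsuc)))
  (sym (sumBelow-+ 1 n f))

sumBelow-≤ᵇ : ∀ {J n} f → J < n →
              sumBelow n (λ i → if i ≤ᵇ J then f i else 0) ≡ sumBelow (suc J) f
sumBelow-≤ᵇ {J} f J<n with m≤n⇒∃[o]m+o≡n J<n
... | e , refl = begin
  sumBelow (suc J + e) g                                ≡⟨ sumBelow-+ (suc J) e g ⟩
  sumBelow (suc J) g + sumBelow e (λ i → g (suc J + i)) ≡⟨ cong₂ _+_ (sumBelow-cong (suc J) upTo-J)
                                                                     (sumBelow-zero e beyond-J) ⟩
  sumBelow (suc J) f + 0                                ≡⟨ +-identityʳ _ ⟩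
  sumBelow (suc J) f                                    ∎
  where
  open ≡-Reasoning
  g = λ i → if i ≤ᵇ J then f i else 0
  upTo-J : ∀ i → i < suc J → g i ≡ f i
  upTo-J i i<1+J rewrite dec-true (i ≤? J) (≤-pred i<1+J) = refl
  beyond-J : ∀ i → i < e → g (suc J + i) ≡ 0
  beyond-J i _ rewrite dec-false (suc J + i ≤? J) (<⇒≱ (s≤s (m≤m+n J i))) = refl

∑-mono-≤ : ∀ {m} {f g : Fin m → ℕ} → (∀ μ → f μ ≤ g μ) → sum f ≤ sum g
∑-mono-≤ {zero}  f≤g = z≤n
∑-mono-≤ {suc m} f≤g = +-mono-≤ (f≤g fzero) (∑-mono-≤ (f≤g ∘ fsuc))

∑-indicator : ∀ {m} x y → x < m → sum {m} (λ μ → if does (x ≟ toℕ μ) then y else 0) ≡ y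
∑-indicator {suc m} zero    y _         = trans (cong (y +_) (sum-replicate-zero m)) (+-identityʳ y)
∑-indicator {suc m} (suc x) y (s≤s x<m) = ∑-indicator x y x<m

length-filter-tabulate : ∀ {A : Set} {Q : A → Set} (Q? : ∀ a → Dec (Q a)) {m} (f : Fin m → A) x →
  length (filter Q? (tabulate f)) * x ≡ sum (λ μ → if does (Q? (f μ)) then x else 0)
length-filter-tabulate Q? {zero}  f x = refl
length-filter-tabulate Q? {suc m} f x with Q? (f fzero)
... | yes _ = cong (x +_) (length-filter-tabulate Q? (f ∘ fsuc) x)
... | no  _ = length-filter-tabulate Q? (f ∘ fsuc) x

-- Loads of machines

load : (ℕ → ℕ) → ℕ → ℕ → (ℕ → ℕ) → ℕ
load M x t w = sumBelow t (λ i → if does (M i ≟ x) then w i else 0)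

load-cong : ∀ {M M′} x t {w w′} →
            (∀ i → i < t → M i ≡ M′ i) → (∀ i → i < t → w i ≡ w′ i) →
            load M x t w ≡ load M′ x t w′
load-cong x t M≡M′ w≡w′ = sumBelow-cong t λ i i<t →
  cong₂ (λ y v → if does (y ≟ x) then v else 0) (M≡M′ i i<t) (w≡w′ i i<t)

load-mono-≤ : ∀ M x t {w w′} → (∀ i → w i ≤ w′ i) → load M x t w ≤ load M x t w′
load-mono-≤ M x t {w} {w′} w≤w′ = sumBelow-mono-≤ t pointwise
  where
  pointwise : ∀ i → i < t →
              (if does (M i ≟ x) then w i else 0) ≤ (if does (M i ≟ x) then w′ i else 0)
  pointwise i _ with does (M i ≟ x)
  ... | true  = w≤w′ i
  ... | false = z≤n

load-idle : ∀ M x t w → (∀ i → i < t → M i ≢ x) → load M x t w ≡ 0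
load-idle M x t w idle =
  sumBelow-zero t (λ i i<t → cong (if_then w i else 0) (dec-false (M i ≟ x) (idle i i<t)))

∑-load : ∀ {m} M t w → (∀ i → i < t → M i < m) →
         sum {m} (λ μ → load M (toℕ μ) t w) ≡ sumBelow t w
∑-load {m} M zero    w M<m = sum-replicate-zero m
∑-load {m} M (suc t) w M<m = begin
  sum {m} (λ μ → load M (toℕ μ) t w + (if does (M t ≟ toℕ μ) then w t else 0))
    ≡⟨ ∑-distrib-+ {m} (λ μ → load M (toℕ μ) t w) _ ⟩
  sum {m} (λ μ → load M (toℕ μ) t w) + sum {m} (λ μ → if does (M t ≟ toℕ μ) then w t else 0)
    ≡⟨ cong₂ _+_ (∑-load M t w (λ i i<t → M<m i (m<n⇒m<1+n i<t)))
                 (∑-indicator (M t) (w t) (M<m t ≤-refl)) ⟩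
  sumBelow t w + w t
    ∎
  where open ≡-Reasoning

load-capped≤slack+c : ∀ (P S M : ℕ → ℕ) T →
  (∀ j → j < T → load M (M j) j P ≤ S j) → (∀ j → j < T → S j ≤ S T) →
  ∀ x c t → t ≤ T → load M x t (λ i → P i ⊓ c) ≤ S T + c
load-capped≤slack+c P S M T feasible monotone x c zero    _   = z≤n
load-capped≤slack+c P S M T feasible monotone x c (suc t) t<T with M t ≟ x
... | no  M[t]≢x rewrite dec-false (M t ≟ x) M[t]≢x =
  ≤-trans (≤-reflexive (+-identityʳ _))
          (load-capped≤slack+c P S M T feasible monotone x c t (<⇒≤ t<T))
... | yes refl rewrite dec-true (M t ≟ M t) refl = +-mono-≤ earlier (m⊓n≤n (P t) c)
  where
  earlier : load M (M t) t (λ i → P i ⊓ c) ≤ S T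
  earlier = ≤-trans (load-mono-≤ M (M t) t (λ i → m⊓n≤m (P i) c))
                    (≤-trans (feasible t t<T) (monotone t t<T))

-- ℕ-indexed versions of  lookup I  and of a schedule; their values past  length I  are junk.

jobAt : Instance → ℕ → Job
jobAt []      _       = job 1 1 (s≤s z≤n) (s≤s z≤n)
jobAt (J ∷ I) zero    = J
jobAt (J ∷ I) (suc i) = jobAt I i

extend : ∀ {n} → (Fin n → ℕ) → ℕ → ℕ
extend {zero}  f _       = 0
extend {suc n} f zero    = f fzero
extend {suc n} f (suc i) = extend (f ∘ fsuc) i

jobAt-lookup : ∀ I (a : Fin (length I)) → jobAt I (toℕ a) ≡ lookup I a
jobAt-lookup (J ∷ I) fzero    = refl
jobAt-lookup (J ∷ I) (fsuc a) = jobAt-lookup I a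

jobAt-fromℕ< : ∀ I {i} (i<n : i < length I) → jobAt I i ≡ lookup I (fromℕ< i<n)
jobAt-fromℕ< I i<n = trans (cong (jobAt I) (sym (Fin.toℕ-fromℕ< i<n))) (jobAt-lookup I (fromℕ< i<n))

extend-toℕ : ∀ {n} (f : Fin n → ℕ) a → extend f (toℕ a) ≡ f a
extend-toℕ f fzero    = refl
extend-toℕ f (fsuc a) = extend-toℕ (f ∘ fsuc) a

extend-fromℕ< : ∀ {n i} (f : Fin n → ℕ) (i<n : i < n) → extend f i ≡ f (fromℕ< i<n)
extend-fromℕ< f i<n = trans (cong (extend f) (sym (Fin.toℕ-fromℕ< i<n))) (extend-toℕ f (fromℕ< i<n))

⌊≟⌋-toℕ : ∀ {m} (μ ν : Fin m) → ⌊ μ Fin.≟ ν ⌋ ≡ does (toℕ μ ≟ toℕ ν)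
⌊≟⌋-toℕ μ ν with μ Fin.≟ ν
... | yes refl = sym (dec-true (toℕ μ ≟ toℕ μ) refl)
... | no  μ≢ν  = sym (dec-false (toℕ μ ≟ toℕ ν) (μ≢ν ∘ Fin.toℕ-injective))

d≡slack+p : ∀ J → d J ≡ slack J + p J
d≡slack+p J = sym (m∸n+n≡m (p≤d J))

slack-monotone : ∀ I → SlackMonotone I → ∀ {i j} → i ≤ j → j < length I →
                 slack (jobAt I i) ≤ slack (jobAt I j)
slack-monotone I monotone {i} {j} i≤j j<n =
  subst₂ _≤_ (cong slack (sym (jobAt-fromℕ< I i<n))) (cong slack (sym (jobAt-fromℕ< I j<n)))
    (monotone (fromℕ< i<n) (fromℕ< j<n)
              (subst₂ _≤_ (sym (Fin.toℕ-fromℕ< i<n)) (sym (Fin.toℕ-fromℕ< j<n)) i≤j))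
  where i<n = ≤-<-trans i≤j j<n

cappedPrefix : Instance → ℕ → ℕ → ℕ
cappedPrefix I c t = sumBelow t (λ i → p (jobAt I i) ⊓ c)

module _ (I : Instance) {m : ℕ} (σ : Schedule I m) where

  machineAt : ℕ → ℕ
  machineAt = extend (toℕ ∘ σ)

  used? : ∀ μ → Dec (∃ λ j → σ j ≡ μ)
  used? μ = Fin.any? (λ j → σ j Fin.≟ μ)

  machineAt-fromℕ< : ∀ {i} (i<n : i < length I) → machineAt i ≡ toℕ (σ (fromℕ< i<n))
  machineAt-fromℕ< = extend-fromℕ< (toℕ ∘ σ)

  machineAt<m : ∀ {i} → i < length I → machineAt i < m
  machineAt<m i<n = subst (_< m) (sym (machineAt-fromℕ< i<n)) (Fin.toℕ<n _)

  machineAt-idle : ∀ {μ i} → ¬ (∃ λ j → σ j ≡ μ) → i < length I → machineAt i ≢ toℕ μ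
  machineAt-idle idle i<n onμ =
    idle (fromℕ< i<n , Fin.toℕ-injective (trans (sym (machineAt-fromℕ< i<n)) onμ))

  startTime : ℕ → ℕ
  startTime J = load machineAt (machineAt J) J (p ∘ jobAt I)

  completion-≡ : ∀ j → completion I σ j ≡ startTime (toℕ j) + p (jobAt I (toℕ j))
  completion-≡ j = begin
    List.sum (map g (tabulate id))
      ≡⟨ cong List.sum (List.map-tabulate id g) ⟩
    List.sum (tabulate g)
      ≡⟨ sumBelow-tabulate (length I) g (λ i → if i ≤ᵇ J then onMachine i else 0) pointwise ⟩
    sumBelow (length I) (λ i → if i ≤ᵇ J then onMachine i else 0)
      ≡⟨ sumBelow-≤ᵇ onMachine (Fin.toℕ<n j) ⟩
    startTime J + onMachine J
      ≡⟨ cong (λ b → startTime J + (if b then p (jobAt I J) else 0))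
              (dec-true (machineAt J ≟ machineAt J) refl) ⟩
    startTime J + p (jobAt I J)
      ∎
    where
    open ≡-Reasoning
    J = toℕ j
    onMachine : ℕ → ℕ
    onMachine i = if does (machineAt i ≟ machineAt J) then p (jobAt I i) else 0
    g : Fin (length I) → ℕ
    g a = if (toℕ a ≤ᵇ J) ∧ ⌊ σ a Fin.≟ σ j ⌋ then p (lookup I a) else 0
    pointwise : ∀ a → g a ≡ (if toℕ a ≤ᵇ J then onMachine (toℕ a) else 0)
    pointwise a rewrite extend-toℕ (toℕ ∘ σ) a | extend-toℕ (toℕ ∘ σ) j
                      | jobAt-lookup I a | ⌊≟⌋-toℕ (σ a) (σ j) with toℕ a ≤ᵇ J
    ... | true  = refl
    ... | false = refl

  feasible⇒startTime≤slack : Feasible I σ → ∀ J → J < length I → startTime J ≤ slack (jobAt I J)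
  feasible⇒startTime≤slack feasible J J<n =
    subst (λ J → startTime J ≤ slack (jobAt I J)) (Fin.toℕ-fromℕ< J<n)
      (+-cancelʳ-≤ _ _ _ (subst₂ _≤_ (completion-≡ j) deadline (feasible j)))
    where
    j = fromℕ< J<n
    deadline : d (lookup I j) ≡ slack (jobAt I (toℕ j)) + p (jobAt I (toℕ j))
    deadline = trans (cong d (sym (jobAt-lookup I j))) (d≡slack+p (jobAt I (toℕ j)))

  startTime≤slack⇒feasible : (∀ J → J < length I → startTime J ≤ slack (jobAt I J)) → Feasible I σ
  startTime≤slack⇒feasible startTime≤slack j =
    subst₂ _≤_ (sym (completion-≡ j)) deadline (+-monoˡ-≤ _ (startTime≤slack (toℕ j) (Fin.toℕ<n j)))
    where
    deadline : slack (jobAt I (toℕ j)) + p (jobAt I (toℕ j)) ≡ d (lookup I j)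
    deadline = trans (sym (d≡slack+p (jobAt I (toℕ j)))) (cong d (jobAt-lookup I j))

  machinesUsed-* : ∀ x → machinesUsed I σ * x ≡ sum (λ μ → if does (used? μ) then x else 0)
  machinesUsed-* = length-filter-tabulate used? id

  module _ (monotone : SlackMonotone I) (feasible : Feasible I σ) (c T : ℕ) (T<n : T < length I) where

    machine-capacity : ∀ μ →
      load machineAt (toℕ μ) T (λ i → p (jobAt I i) ⊓ c) + (if does (machineAt T ≟ toℕ μ) then c else 0)
        ≤ (if does (used? μ) then slack (jobAt I T) + c else 0)
    machine-capacity μ with used? μ
    ... | no idle rewrite load-idle machineAt (toℕ μ) T (λ i → p (jobAt I i) ⊓ c)
                                    (λ i i<T → machineAt-idle idle (<-trans i<T T<n))
                        | dec-false (machineAt T ≟ toℕ μ) (machineAt-idle idle T<n) = z≤n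
    ... | yes _ with machineAt T ≟ toℕ μ
    ...   | no  M[T]≢μ rewrite dec-false (machineAt T ≟ toℕ μ) M[T]≢μ =
      ≤-trans (≤-reflexive (+-identityʳ _))
              (load-capped≤slack+c (p ∘ jobAt I) (slack ∘ jobAt I) machineAt T
                 (λ j j<T → feasible⇒startTime≤slack feasible j (<-trans j<T T<n))
                 (λ j j<T → slack-monotone I monotone (<⇒≤ j<T) T<n)
                 (toℕ μ) c T ≤-refl)
    ...   | yes onμ rewrite dec-true (machineAt T ≟ toℕ μ) onμ | sym onμ =
      +-monoˡ-≤ c (≤-trans (load-mono-≤ machineAt (machineAt T) T (λ i → m⊓n≤m (p (jobAt I i)) c))
                           (feasible⇒startTime≤slack feasible T T<n))

    cappedPrefix+c≤machinesUsed* : cappedPrefix I c T + c ≤ machinesUsed I σ * (slack (jobAt I T) + c)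
    cappedPrefix+c≤machinesUsed* = begin
      sumBelow T w + c
        ≡⟨ cong₂ _+_ (∑-load machineAt T w (λ i i<T → machineAt<m (<-trans i<T T<n)))
                     (∑-indicator (machineAt T) c (machineAt<m T<n)) ⟨
      sum {m} (λ μ → load machineAt (toℕ μ) T w)
        + sum {m} (λ μ → if does (machineAt T ≟ toℕ μ) then c else 0)
        ≡⟨ ∑-distrib-+ {m} _ _ ⟨
      sum {m} (λ μ → load machineAt (toℕ μ) T w + (if does (machineAt T ≟ toℕ μ) then c else 0))
        ≤⟨ ∑-mono-≤ machine-capacity ⟩
      sum (λ μ → if does (used? μ) then slack (jobAt I T) + c else 0)
        ≡⟨ machinesUsed-* _ ⟨
      machinesUsed I σ * (slack (jobAt I T) + c)
        ∎
      where
      open ≤-Reasoning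
      w = λ i → p (jobAt I i) ⊓ c

-- First fit

cappedLoads : ℕ → List ℕ → ℕ
cappedLoads c ls = List.sum (map (_⊓ c) ls)

[m+n]⊓o≤m⊓o+n⊓o : ∀ m n o → (m + n) ⊓ o ≤ m ⊓ o + n ⊓ o
[m+n]⊓o≤m⊓o+n⊓o m n o with ≤-total o m | ≤-total o n
... | inj₁ o≤m | _        =
  ≤-trans (m⊓n≤n (m + n) o) (subst (_≤ m ⊓ o + n ⊓ o) (m≥n⇒m⊓n≡n o≤m) (m≤m+n (m ⊓ o) (n ⊓ o)))
... | inj₂ _   | inj₁ o≤n =
  ≤-trans (m⊓n≤n (m + n) o) (subst (_≤ m ⊓ o + n ⊓ o) (m≥n⇒m⊓n≡n o≤n) (m≤n+m (n ⊓ o) (m ⊓ o)))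
... | inj₂ m≤o | inj₂ n≤o =
  ≤-trans (m⊓n≤m (m + n) o) (≤-reflexive (sym (cong₂ _+_ (m≤n⇒m⊓n≡m m≤o) (m≤n⇒m⊓n≡m n≤o))))

place-fit : ∀ J {ℓ} ls → ℓ + p J ≤ d J → place J (ℓ ∷ ls) ≡ ℓ + p J ∷ ls
place-fit J {ℓ} ls fits with ℓ + p J ≤? d J
... | yes _     = refl
... | no  ¬fits = contradiction fits ¬fits

place-skip : ∀ J {ℓ} ls → ¬ ℓ + p J ≤ d J → place J (ℓ ∷ ls) ≡ ℓ ∷ place J ls
place-skip J {ℓ} ls ¬fits with ℓ + p J ≤? d J
... | yes fits = contradiction fits ¬fits
... | no  _    = refl

cappedLoads-place : ∀ c J ls → cappedLoads c (place J ls) ≤ cappedLoads c ls + p J ⊓ c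
cappedLoads-place c J []       = ≤-reflexive (+-comm (p J ⊓ c) 0)
cappedLoads-place c J (ℓ ∷ ls) with ℓ + p J ≤? d J
... | yes _ = begin
  (ℓ + p J) ⊓ c + cappedLoads c ls      ≤⟨ +-monoˡ-≤ _ ([m+n]⊓o≤m⊓o+n⊓o ℓ (p J) c) ⟩
  ℓ ⊓ c + p J ⊓ c + cappedLoads c ls    ≡⟨ +-assoc (ℓ ⊓ c) _ _ ⟩
  ℓ ⊓ c + (p J ⊓ c + cappedLoads c ls)  ≡⟨ cong (ℓ ⊓ c +_) (+-comm (p J ⊓ c) _) ⟩
  ℓ ⊓ c + (cappedLoads c ls + p J ⊓ c)  ≡⟨ +-assoc (ℓ ⊓ c) _ _ ⟨
  ℓ ⊓ c + cappedLoads c ls + p J ⊓ c    ∎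
  where open ≤-Reasoning
... | no  _ = ≤-trans (+-monoʳ-≤ (ℓ ⊓ c) (cappedLoads-place c J ls))
                      (≤-reflexive (sym (+-assoc (ℓ ⊓ c) _ _)))

length-place : ∀ J ls → length (place J ls) ≡ length ls
                      ⊎ length (place J ls) ≡ suc (length ls) × All (λ ℓ → slack J < ℓ) ls
length-place J []       = inj₂ (refl , [])
length-place J (ℓ ∷ ls) with ℓ + p J ≤? d J
... | yes _     = inj₁ refl
... | no  ¬fits with length-place J ls
...   | inj₁ same           = inj₁ (cong suc same)
...   | inj₂ (opens , full) = inj₂ (cong suc opens , slack<ℓ ∷ full)
  where
  slack<ℓ : slack J < ℓ
  slack<ℓ = +-cancelʳ-< (p J) (slack J) ℓ (subst (_< ℓ + p J) (d≡slack+p J) (≰⇒> ¬fits))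

cappedLoads-full : ∀ s ls → All (s <_) ls → length ls * suc s ≤ cappedLoads (suc s) ls
cappedLoads-full s []       []           = z≤n
cappedLoads-full s (ℓ ∷ ls) (s<ℓ ∷ full) =
  +-mono-≤ (≤-reflexive (sym (m≥n⇒m⊓n≡n s<ℓ))) (cappedLoads-full s ls full)

drop≡∷ : ∀ (I : Instance) t {J rest} → drop t I ≡ J ∷ rest →
         jobAt I t ≡ J × t < length I × drop (suc t) I ≡ rest
drop≡∷ (J ∷ I) zero    refl = refl , s≤s z≤n , refl
drop≡∷ (J ∷ I) (suc t) eq   with drop≡∷ I t eq
... | at , t<n , rest = at , s≤s t<n , rest

module _ (I : Instance) (k : ℕ)
  (capacity : ∀ c T → T < length I → cappedPrefix I c T + c ≤ k * (slack (jobAt I T) + c))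
  where

  LoadInvariant : ℕ → List ℕ → Set
  LoadInvariant t ls = (∀ c → cappedLoads c ls ≤ cappedPrefix I c t) × length ls ≤ 2 * k

  place-invariant : ∀ {t J rest ls} → drop t I ≡ J ∷ rest → LoadInvariant t ls →
                    LoadInvariant (suc t) (place J ls)
  place-invariant {t} {ls = ls} dropped (capped , few) with drop≡∷ I t dropped
  ... | refl , t<n , _ = capped′ , few′
    where
    J = jobAt I t
    capped′ : ∀ c → cappedLoads c (place J ls) ≤ cappedPrefix I c (suc t)
    capped′ c = ≤-trans (cappedLoads-place c J ls) (+-monoˡ-≤ (p J ⊓ c) (capped c))
    few′ : length (place J ls) ≤ 2 * k
    few′ with length-place J ls
    ... | inj₁ same           = subst (_≤ 2 * k) (sym same) few
    ... | inj₂ (opens , full) =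
      subst (_≤ 2 * k) (sym opens) (*-cancelʳ-≤ (suc (length ls)) (2 * k) c bound)
      where
      c = suc (slack J)
      bound : suc (length ls) * c ≤ 2 * k * c
      bound = begin
        suc (length ls) * c       ≡⟨ +-comm c _ ⟩
        length ls * c + c         ≤⟨ +-monoˡ-≤ c (cappedLoads-full (slack J) ls full) ⟩
        cappedLoads c ls + c      ≤⟨ +-monoˡ-≤ c (capped c) ⟩
        cappedPrefix I c t + c    ≤⟨ capacity c t t<n ⟩
        k * (slack J + c)         ≤⟨ *-monoʳ-≤ k (+-monoˡ-≤ c (n≤1+n (slack J))) ⟩
        k * (c + c)               ≡⟨ double k c ⟩
        2 * k * c                 ∎
        where
        open ≤-Reasoning
        double : ∀ k c → k * (c + c) ≡ 2 * k * c
        double = solve-∀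

  ffLoads-invariant : ∀ t {rest ls} → drop t I ≡ rest → LoadInvariant t ls →
                      length (ffLoads ls rest) ≤ 2 * k
  ffLoads-invariant t {[]}       _       (_ , few) = few
  ffLoads-invariant t {J ∷ rest} {ls} dropped inv =
    ffLoads-invariant (suc t) (proj₂ (proj₂ (drop≡∷ I t dropped)))
                      (place-invariant {ls = ls} dropped inv)

  FF≤2*k : FF I ≤ 2 * k
  FF≤2*k = ffLoads-invariant 0 refl ((λ _ → z≤n) , z≤n)

FF≤2*OPT : (I : Instance) → SlackMonotone I → (k : ℕ) → IsOPT I k → FF I ≤ 2 * k
FF≤2*OPT I monotone k ((_ , σ , feasible , used≡k) , _) = FF≤2*k I k λ c T T<n →
  subst (λ u → cappedPrefix I c T + c ≤ u * (slack (jobAt I T) + c)) used≡k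
        (cappedPrefix+c≤machinesUsed* I σ monotone feasible c T T<n)

-- A tight family

replicate-+ : ∀ {A : Set} m n (x : A) → replicate (m + n) x ≡ replicate m x ++ replicate n x
replicate-+ zero    n x = refl
replicate-+ (suc m) n x = cong (x ∷_) (replicate-+ m n x)

replicate-∷ʳ : ∀ {A : Set} q (x : A) → replicate q x ++ x ∷ [] ≡ replicate (suc q) x
replicate-∷ʳ zero    x = refl
replicate-∷ʳ (suc q) x = cong (x ∷_) (replicate-∷ʳ q x)

jobAt-++ˡ : ∀ xs ys {i} → i < length xs → jobAt (xs ++ ys) i ≡ jobAt xs i
jobAt-++ˡ (J ∷ xs) ys {zero}  _         = refl
jobAt-++ˡ (J ∷ xs) ys {suc i} (s≤s i<n) = jobAt-++ˡ xs ys i<n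

jobAt-++ʳ : ∀ xs ys i → jobAt (xs ++ ys) (length xs + i) ≡ jobAt ys i
jobAt-++ʳ []       ys i = refl
jobAt-++ʳ (J ∷ xs) ys i = jobAt-++ʳ xs ys i

jobAt-replicate : ∀ q J {i} → i < q → jobAt (replicate q J) i ≡ J
jobAt-replicate (suc q) J {zero}  _         = refl
jobAt-replicate (suc q) J {suc i} (s≤s i<q) = jobAt-replicate q J i<q

ffLoads-++ : ∀ ls xs ys → ffLoads ls (xs ++ ys) ≡ ffLoads (ffLoads ls xs) ys
ffLoads-++ ls []       ys = refl
ffLoads-++ ls (J ∷ xs) ys = ffLoads-++ (place J ls) xs ys

place-skip-replicate : ∀ J {ℓ} q ls → ¬ ℓ + p J ≤ d J →
                       place J (replicate q ℓ ++ ls) ≡ replicate q ℓ ++ place J ls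
place-skip-replicate J zero    ls ¬fits = refl
place-skip-replicate J (suc q) ls ¬fits =
  trans (place-skip J _ ¬fits) (cong (_ ∷_) (place-skip-replicate J q ls ¬fits))

place-replicate-full : ∀ J {ℓ} q → ¬ ℓ + p J ≤ d J →
                       place J (replicate q ℓ) ≡ replicate q ℓ ++ p J ∷ []
place-replicate-full J {ℓ} q ¬fits =
  subst (λ ls → place J ls ≡ replicate q ℓ ++ p J ∷ []) (List.++-identityʳ (replicate q ℓ))
        (place-skip-replicate J q [] ¬fits)

module TightFamily (b : ℕ) where

  K : ℕ
  K = suc b

  small big : Job
  small = job 1 K (s≤s z≤n) (s≤s z≤n)
  big   = job K (K + b) (s≤s z≤n) (m≤m+n K b)

  I₀ : Instance
  I₀ = replicate (b * K) small ++ replicate K big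

  length-I₀ : length I₀ ≡ b * K + K
  length-I₀ = trans (List.length-++ (replicate (b * K) small))
                    (cong₂ _+_ (List.length-replicate (b * K)) (List.length-replicate K))

  jobAt-small : ∀ {i} → i < b * K → jobAt I₀ i ≡ small
  jobAt-small i<bK =
    trans (jobAt-++ˡ (replicate (b * K) small) _ (subst (_ <_) (sym (List.length-replicate (b * K))) i<bK))
          (jobAt-replicate (b * K) small i<bK)

  jobAt-big : ∀ {v} → v < K → jobAt I₀ (b * K + v) ≡ big
  jobAt-big {v} v<K =
    trans (cong (λ n → jobAt I₀ (n + v)) (sym (List.length-replicate (b * K))))
          (trans (jobAt-++ʳ (replicate (b * K) small) _ v) (jobAt-replicate K big v<K))

  data Position : ℕ → Set where
    smallAt : ∀ {i} → i < b * K → Position i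
    bigAt   : ∀ {v} → v < K → Position (b * K + v)

  position : ∀ {i} → i < length I₀ → Position i
  position {i} i<n with i <? b * K
  ... | yes i<bK = smallAt i<bK
  ... | no  i≮bK with m≤n⇒∃[o]m+o≡n (≮⇒≥ i≮bK)
  ...   | v , refl = bigAt (+-cancelˡ-< (b * K) v K (subst (b * K + v <_) length-I₀ i<n))

  slack-I₀ : ∀ {i} → i < length I₀ → slack (jobAt I₀ i) ≡ b
  slack-I₀ i<n with position i<n
  ... | smallAt i<bK = cong slack (jobAt-small i<bK)
  ... | bigAt   v<K  = trans (cong slack (jobAt-big v<K)) (m+n∸m≡n K b)

  slackMonotone : SlackMonotone I₀
  slackMonotone i j _ = ≤-reflexive (trans (slack-lookup i) (sym (slack-lookup j)))
    where
    slack-lookup : ∀ a → slack (lookup I₀ a) ≡ b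
    slack-lookup a = trans (cong slack (sym (jobAt-lookup I₀ a))) (slack-I₀ (Fin.toℕ<n a))

  small-overflows : ¬ K + p small ≤ d small
  small-overflows = <⇒≱ (m<m+n K (s≤s z≤n))

  big-overflows : ¬ K + p big ≤ d big
  big-overflows = <⇒≱ (+-monoʳ-< K (n<1+n b))

  small-fill : ∀ q x u → x + u ≤ K →
               ffLoads (replicate q K ++ x ∷ []) (replicate u small) ≡ replicate q K ++ x + u ∷ []
  small-fill q x zero    _     = cong (λ y → replicate q K ++ y ∷ []) (sym (+-identityʳ x))
  small-fill q x (suc u) x+u≤K = begin
    ffLoads (place small (replicate q K ++ x ∷ [])) (replicate u small)
      ≡⟨ cong (λ ls → ffLoads ls (replicate u small))
              (trans (place-skip-replicate small q (x ∷ []) small-overflows)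
                     (cong (replicate q K ++_) (place-fit small [] x+1≤K))) ⟩
    ffLoads (replicate q K ++ x + 1 ∷ []) (replicate u small)
      ≡⟨ small-fill q (x + 1) u (subst (_≤ K) (sym (+-assoc x 1 u)) x+u≤K) ⟩
    replicate q K ++ x + 1 + u ∷ []
      ≡⟨ cong (λ y → replicate q K ++ y ∷ []) (+-assoc x 1 u) ⟩
    replicate q K ++ x + suc u ∷ []
      ∎
    where
    open ≡-Reasoning
    x+1≤K : x + 1 ≤ K
    x+1≤K = ≤-trans (+-monoʳ-≤ x (s≤s z≤n)) x+u≤K

  small-block : ∀ q → ffLoads (replicate q K) (replicate K small) ≡ replicate (suc q) K
  small-block q = begin
    ffLoads (place small (replicate q K)) (replicate b small)
      ≡⟨ cong (λ ls → ffLoads ls (replicate b small)) (place-replicate-full small q small-overflows) ⟩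
    ffLoads (replicate q K ++ 1 ∷ []) (replicate b small)
      ≡⟨ small-fill q 1 b ≤-refl ⟩
    replicate q K ++ K ∷ []
      ≡⟨ replicate-∷ʳ q K ⟩
    replicate (suc q) K
      ∎
    where open ≡-Reasoning

  small-phase : ∀ r q → ffLoads (replicate q K) (replicate (r * K) small) ≡ replicate (r + q) K
  small-phase zero    q = refl
  small-phase (suc r) q = begin
    ffLoads (replicate q K) (replicate (K + r * K) small)
      ≡⟨ cong (ffLoads (replicate q K)) (replicate-+ K (r * K) small) ⟩
    ffLoads (replicate q K) (replicate K small ++ replicate (r * K) small)
      ≡⟨ ffLoads-++ (replicate q K) (replicate K small) _ ⟩
    ffLoads (ffLoads (replicate q K) (replicate K small)) (replicate (r * K) small)
      ≡⟨ cong (λ ls → ffLoads ls (replicate (r * K) small)) (small-block q) ⟩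
    ffLoads (replicate (suc q) K) (replicate (r * K) small)
      ≡⟨ small-phase r (suc q) ⟩
    replicate (r + suc q) K
      ≡⟨ cong (λ n → replicate n K) (+-suc r q) ⟩
    replicate (suc r + q) K
      ∎
    where open ≡-Reasoning

  big-phase : ∀ u q → ffLoads (replicate q K) (replicate u big) ≡ replicate (u + q) K
  big-phase zero    q = refl
  big-phase (suc u) q = begin
    ffLoads (place big (replicate q K)) (replicate u big)
      ≡⟨ cong (λ ls → ffLoads ls (replicate u big))
              (trans (place-replicate-full big q big-overflows) (replicate-∷ʳ q K)) ⟩
    ffLoads (replicate (suc q) K) (replicate u big)
      ≡⟨ big-phase u (suc q) ⟩
    replicate (u + suc q) K
      ≡⟨ cong (λ n → replicate n K) (+-suc u q) ⟩
    replicate (suc u + q) K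
      ∎
    where open ≡-Reasoning

  FF-I₀ : FF I₀ ≡ K + b
  FF-I₀ = begin
    length (ffLoads [] (replicate (b * K) small ++ replicate K big))
      ≡⟨ cong length (ffLoads-++ [] (replicate (b * K) small) _) ⟩
    length (ffLoads (ffLoads [] (replicate (b * K) small)) (replicate K big))
      ≡⟨ cong (λ ls → length (ffLoads ls (replicate K big))) (small-phase b 0) ⟩
    length (ffLoads (replicate (b + 0) K) (replicate K big))
      ≡⟨ cong length (big-phase K (b + 0)) ⟩
    length (replicate (K + (b + 0)) K)
      ≡⟨ List.length-replicate (K + (b + 0)) ⟩
    K + (b + 0)
      ≡⟨ cong (K +_) (+-identityʳ b) ⟩
    K + b
      ∎
    where open ≡-Reasoning

  roundRobin : Schedule I₀ K
  roundRobin a = fromℕ< (m%n<n (toℕ a) K)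

  machineAt-roundRobin : ∀ {i} → i < length I₀ → machineAt I₀ roundRobin i ≡ i % K
  machineAt-roundRobin i<n =
    trans (machineAt-fromℕ< I₀ roundRobin i<n)
          (trans (Fin.toℕ-fromℕ< _) (cong (_% K) (Fin.toℕ-fromℕ< i<n)))

  [bK+v]%K≡v : ∀ {v} → v < K → (b * K + v) % K ≡ v
  [bK+v]%K≡v {v} v<K =
    trans (cong (_% K) (+-comm (b * K) v)) (trans ([m+kn]%n≡m%n v b K) (m<n⇒m%n≡m v<K))

  residue-count : ∀ q {u} → u < K → load (_% K) u (q * K) (λ _ → 1) ≡ q
  residue-count zero    u<K = refl
  residue-count (suc q) {u} u<K = begin
    sumBelow (K + q * K) f                             ≡⟨ sumBelow-+ K (q * K) f ⟩
    sumBelow K f + sumBelow (q * K) (λ i → f (K + i))  ≡⟨ cong₂ _+_ firstBlock laterBlocks ⟩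
    1 + q                                              ∎
    where
    open ≡-Reasoning
    indicator = λ r → if does (r ≟ u) then 1 else 0
    f = λ i → indicator (i % K)
    firstBlock : sumBelow K f ≡ 1
    firstBlock = trans (sumBelow-cong K (λ i i<K → cong indicator (m<n⇒m%n≡m i<K)))
                       (sumBelow-indicator 1 u<K)
    laterBlocks : sumBelow (q * K) (λ i → f (K + i)) ≡ q
    laterBlocks = trans (sumBelow-cong (q * K) λ i _ →
                           cong indicator (trans (cong (_% K) (+-comm K i)) ([m+n]%n≡m%n i K)))
                        (residue-count q u<K)

  smalls-load : ∀ {u} → u < K → load (_% K) u (b * K) (p ∘ jobAt I₀) ≡ b
  smalls-load {u} u<K =
    trans (load-cong {_% K} {_% K} u (b * K) (λ _ _ → refl) (λ i i<bK → cong p (jobAt-small i<bK)))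
          (residue-count b u<K)

  roundRobin-load : ∀ {J} → J < length I₀ → load (_% K) (J % K) J (p ∘ jobAt I₀) ≤ b
  roundRobin-load {J} J<n with position J<n
  ... | smallAt J<bK = begin
    load (_% K) (J % K) J (p ∘ jobAt I₀)        ≤⟨ sumBelow-prefix-≤ _ (<⇒≤ J<bK) ⟩
    load (_% K) (J % K) (b * K) (p ∘ jobAt I₀)  ≡⟨ smalls-load (m%n<n J K) ⟩
    b                                           ∎
    where open ≤-Reasoning
  ... | bigAt {v} v<K = ≤-reflexive (begin
    load (_% K) ((b * K + v) % K) (b * K + v) (p ∘ jobAt I₀)
      ≡⟨ cong (λ u → load (_% K) u (b * K + v) (p ∘ jobAt I₀)) ([bK+v]%K≡v v<K) ⟩
    load (_% K) v (b * K + v) (p ∘ jobAt I₀)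
      ≡⟨ sumBelow-+ (b * K) v _ ⟩
    load (_% K) v (b * K) (p ∘ jobAt I₀) + sumBelow v onMachine-v
      ≡⟨ cong₂ _+_ (smalls-load v<K) (sumBelow-zero v otherMachines) ⟩
    b + 0
      ≡⟨ +-identityʳ b ⟩
    b ∎)
    where
    open ≡-Reasoning
    onMachine-v = λ w → if does ((b * K + w) % K ≟ v) then p (jobAt I₀ (b * K + w)) else 0
    otherMachines : ∀ w → w < v → onMachine-v w ≡ 0
    otherMachines w w<v = cong (if_then p (jobAt I₀ (b * K + w)) else 0)
      (dec-false ((b * K + w) % K ≟ v) (<⇒≢ (subst (_< v) (sym ([bK+v]%K≡v (<-trans w<v v<K))) w<v)))

  roundRobin-feasible : Feasible I₀ roundRobin
  roundRobin-feasible = startTime≤slack⇒feasible I₀ roundRobin λ J J<n →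
    subst₂ _≤_ (load-cong _ J (λ i i<J → sym (machineAt-roundRobin (<-trans i<J J<n))) (λ _ _ → refl))
               (sym (slack-I₀ J<n))
               (subst (λ u → load (_% K) u J (p ∘ jobAt I₀) ≤ b) (sym (machineAt-roundRobin J<n))
                      (roundRobin-load J<n))

  roundRobin-uses-all : machinesUsed I₀ roundRobin ≡ K
  roundRobin-uses-all =
    trans (cong length (List.filter-all (used? I₀ roundRobin) (tabulate⁺ used)))
          (List.length-tabulate id)
    where
    K≤n : K ≤ length I₀
    K≤n = subst (K ≤_) (sym length-I₀) (m≤n+m K (b * K))
    used : ∀ μ → ∃ λ j → roundRobin j ≡ μ
    used μ = j , Fin.toℕ-injective (begin
      toℕ (fromℕ< (m%n<n (toℕ j) K)) ≡⟨ Fin.toℕ-fromℕ< _ ⟩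
      toℕ j % K                      ≡⟨ cong (_% K) (Fin.toℕ-fromℕ< j<n) ⟩
      toℕ μ % K                      ≡⟨ m<n⇒m%n≡m (Fin.toℕ<n μ) ⟩
      toℕ μ                          ∎)
      where
      open ≡-Reasoning
      j<n = <-≤-trans (Fin.toℕ<n μ) K≤n
      j = fromℕ< j<n

  K≤machinesUsed : ∀ {m} (σ : Schedule I₀ m) → Feasible I₀ σ → K ≤ machinesUsed I₀ σ
  K≤machinesUsed σ feasible = *-cancelʳ-≤ K (machinesUsed I₀ σ) (K + b) (begin
    K * (K + b)                                   ≡⟨ expand b ⟩
    b * K * 1 + b * K + K                         ≡⟨ cong (_+ K) mass ⟨
    cappedPrefix I₀ K T + K
      ≤⟨ cappedPrefix+c≤machinesUsed* I₀ σ slackMonotone feasible K T T<n ⟩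
    machinesUsed I₀ σ * (slack (jobAt I₀ T) + K)
      ≡⟨ cong (λ s → machinesUsed I₀ σ * (s + K)) (slack-I₀ T<n) ⟩
    machinesUsed I₀ σ * (b + K)
      ≡⟨ cong (machinesUsed I₀ σ *_) (+-comm b K) ⟩
    machinesUsed I₀ σ * (K + b)
      ∎)
    where
    open ≤-Reasoning
    expand : ∀ b → suc b * (suc b + b) ≡ b * suc b * 1 + b * suc b + suc b
    expand = solve-∀
    T = b * K + b
    T<n : T < length I₀
    T<n = subst (T <_) (sym length-I₀) (+-monoʳ-< (b * K) (n<1+n b))
    mass : cappedPrefix I₀ K T ≡ b * K * 1 + b * K
    mass = trans (sumBelow-+ (b * K) b _) (cong₂ _+_
      (trans (sumBelow-cong (b * K) λ i i<bK → cong (λ J → p J ⊓ K) (jobAt-small i<bK))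
             (sumBelow-const (b * K) 1))
      (trans (sumBelow-cong b λ v v<b → trans (cong (λ J → p J ⊓ K) (jobAt-big (<-trans v<b (n<1+n b))))
                                              (⊓-idem K))
             (sumBelow-const b K)))

  isOPT : IsOPT I₀ K
  isOPT = (K , roundRobin , roundRobin-feasible , roundRobin-uses-all) , λ _ → K≤machinesUsed

  ratio : ∀ a → 0 < a → 2 * b * K < b * FF I₀ + a * K
  ratio a@(suc _) _ = begin-strict
    2 * b * K            ≡⟨ expand b ⟩
    b * (K + b) + b      <⟨ +-monoʳ-< (b * (K + b)) (<-≤-trans (n<1+n b) (m≤n*m K a)) ⟩
    b * (K + b) + a * K  ≡⟨ cong (λ f → b * f + a * K) FF-I₀ ⟨
    b * FF I₀ + a * K    ∎
    where
    open ≤-Reasoning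
    expand : ∀ b → 2 * b * suc b ≡ b * (suc b + b) + b
    expand = solve-∀

theorem3 :
    ((I : Instance) → SlackMonotone I → (k : ℕ) → IsOPT I k → FF I ≤ 2 * k)
    ×
    ((a b : ℕ) → 0 < a → 0 < b →
      Σ Instance λ I → SlackMonotone I × Σ ℕ λ k → IsOPT I k ×
        (2 * b) * k < b * FF I + a * k)
theorem3 = FF≤2*OPT , λ a b 0<a _ →
  let open TightFamily b in I₀ , slackMonotone , K , isOPT , ratio a 0<a
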